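{- Let $G$ be a finite connected graph with at least one edge, $\Delta$ a decision tree for $G$, and $T$ a spanning tree of $G$. Then every edge of $\Delta$-type $\mathbf I$ for $T$ belongs to $T$, and every edge of $\Delta$-type $\mathbf L$ for $T$ does not belong to $T$.
   Context: Graphs are finite, loops and multiple edges allowed; $m=|E(G)|$. Subgraphs are spanning, identified with edge sets. An isthmus is an edge whose deletion increases the number of connected components; an edge is standard if neither a loop nor an isthmus. A decision tree for $G$ is a perfect binary tree with all leaves at depth $m-1$ (root at depth $0$), each node labelled by an edge of $G$, such that along every root-to-leaf path the labels form a permutation of $E(G)$. Given a subgraph $S$, the $\Delta$-types are assigned by: set $H:=G$, $n:=$ root of $\Delta$; for $k=1,\dots,m$ let $e_k$ be the label of $n$ and do exactly one of: (i) if $e_k$ is standard in $H$ and $e_k\notin S$: type $\mathbf S_e$, $H:=H\setminus e_k$ (deletion), $n:=$ left child; (ii) if $e_k$ is a loop of $H$: type $\mathbf L$, $H:=H\setminus e_k$, $n:=$ left child; (iii) if $e_k$ is standard in $H$ and $e_k\in S$: type $\mathbf S_i$, $H:=H/e_k$ (contraction), $n:=$ right child; (iv) if $e_k$ is an isthmus of $H$: type $\mathbf I$, $H:=H/e_k$, $n:=$ right child. -}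

module Defs where

open import Data.Nat using (ℕ; zero; suc)
open import Data.Fin using (Fin; _≟_)
open import Data.Bool using (Bool; true; false; if_then_else_)
open import Data.Product using (Σ; ∃; ∃-syntax; _×_; _,_; proj₁; proj₂)
open import Data.Product using () renaming (map to ×-map)
open import Data.Sum using (_⊎_)
open import Data.Unit using (⊤)
open import Data.List using (List; []; _∷_; allFin)
open import Data.List.Relation.Unary.Unique.Propositional using (Unique)
open import Data.List.Relation.Binary.Permutation.Propositional using (_↭_)
open import Data.Vec using (Vec; []; _∷_)
open import Relation.Nullary using (¬_; does)
open import Relation.Binary.PropositionalEquality using (_≡_; _≢_)

-- Finite multigraphs (loops and multiple edges allowed).
-- Vertices Fin nV, edges Fin nE, each edge has an (ordered) pair of ends.

record Graph : Set where
  field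
    nV   : ℕ
    nE   : ℕ
    ends : Fin nE → Fin nV × Fin nV
open Graph public

-- Walks using only edges satisfying P (w.r.t. an endpoint map).
-- Walk ends P u v es vs : a walk from u to v traversing edges es,
-- vs = the list of vertices at which each step starts.

Incid : ∀ {n m} → (Fin m → Fin n × Fin n) → Fin m → Fin n → Fin n → Set
Incid ends f u w = (ends f ≡ (u , w)) ⊎ (ends f ≡ (w , u))

data Walk {n m : ℕ} (ends : Fin m → Fin n × Fin n) (P : Fin m → Set)
     : Fin n → Fin n → List (Fin m) → List (Fin n) → Set where
  nil  : ∀ {u} → Walk ends P u u [] []
  cons : ∀ {u w v f es vs} → P f → Incid ends f u w →
         Walk ends P w v es vs → Walk ends P u v (f ∷ es) (u ∷ vs)

Joined : ∀ {n m} → (Fin m → Fin n × Fin n) → (Fin m → Set) → Fin n → Fin n → Set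
Joined ends P u v = ∃[ es ] ∃[ vs ] Walk ends P u v es vs

ConnectedSub : ∀ {n m} → (Fin m → Fin n × Fin n) → (Fin m → Set) → Set
ConnectedSub {n} ends P = (u v : Fin n) → Joined ends P u v

HasCycle : ∀ {n m} → (Fin m → Fin n × Fin n) → (Fin m → Set) → Set
HasCycle ends P =
  ∃[ u ] ∃[ es ] ∃[ vs ] (Walk ends P u u es vs × es ≢ [] × Unique es × Unique vs)

GraphConnected : Graph → Set
GraphConnected G = ConnectedSub (ends G) (λ _ → ⊤)

Subgraph : Graph → Set
Subgraph G = Fin (nE G) → Bool

InSub : ∀ {G} → Subgraph G → Fin (nE G) → Set
InSub S f = S f ≡ true

IsSpanningTree : (G : Graph) → Subgraph G → Set
IsSpanningTree G T = ConnectedSub (ends G) (InSub {G} T) × ¬ HasCycle (ends G) (InSub {G} T)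

-- Edges keep their
-- identity (labels are edges of G).  Contracting edge e with ends (a , b)
-- renames b to a in all endpoints and removes e; b then remains as an
-- isolated vertex, which affects neither loops nor isthmuses.

record Minor (n m : ℕ) : Set where
  field
    mends   : Fin m → Fin n × Fin n
    present : Fin m → Bool
open Minor public

Present : ∀ {n m} → Minor n m → Fin m → Set
Present H f = present H f ≡ true

initial : (G : Graph) → Minor (nV G) (nE G)
initial G = record { mends = ends G ; present = λ _ → true }

delete : ∀ {n m} → Minor n m → Fin m → Minor n m
delete H e = record
  { mends = mends H
  ; present = λ f → if does (f ≟ e) then false else present H f }

contract : ∀ {n m} → Minor n m → Fin m → Minor n m
contract {n} H e = record
  { mends = λ f → ×-map rn rn (mends H f)
  ; present = present (delete H e) }
  where
  a b : Fin n
  a = proj₁ (mends H e)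
  b = proj₂ (mends H e)
  rn : Fin n → Fin n
  rn x = if does (x ≟ b) then a else x

JoinedIn : ∀ {n m} → Minor n m → Fin n → Fin n → Set
JoinedIn H = Joined (mends H) (Present H)

IsLoop : ∀ {n m} → Minor n m → Fin m → Set
IsLoop H e = Present H e × proj₁ (mends H e) ≡ proj₂ (mends H e)

-- deleting e increases the number of components, i.e. some pair of
-- vertices joined in H is no longer joined in H ∖ e
IsIsthmus : ∀ {n m} → Minor n m → Fin m → Set
IsIsthmus H e = Present H e ×
  (∃[ u ] ∃[ v ] (JoinedIn H u v × ¬ JoinedIn (delete H e) u v))

IsStandard : ∀ {n m} → Minor n m → Fin m → Set
IsStandard H e = Present H e × ¬ IsLoop H e × ¬ IsIsthmus H e

data DTree (m : ℕ) : ℕ → Set where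
  leaf : Fin m → DTree m zero
  node : ∀ {k} → Fin m → DTree m k → DTree m k → DTree m (suc k)

-- labels along the root-to-leaf path given by directions (false = left)
pathLabels : ∀ {m k} → DTree m k → Vec Bool k → List (Fin m)
pathLabels (leaf e) [] = e ∷ []
pathLabels (node e l r) (false ∷ p) = e ∷ pathLabels l p
pathLabels (node e l r) (true ∷ p) = e ∷ pathLabels r p

IsDecisionTree : ∀ {m k} → DTree m k → Set
IsDecisionTree {m} {k} t = (p : Vec Bool k) → pathLabels t p ↭ allFin m

data EType : Set where
  Se L Si I : EType

-- one step of the process: (type, new minor, direction: false = left)
data Step {n m} (S : Fin m → Bool) (H : Minor n m) (e : Fin m)
     : EType → Minor n m → Bool → Set where
  stepSe : IsStandard H e → S e ≡ false → Step S H e Se (delete H e) false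
  stepL  : IsLoop H e → Step S H e L (delete H e) false
  stepSi : IsStandard H e → S e ≡ true → Step S H e Si (contract H e) true
  stepI  : IsIsthmus H e → Step S H e I (contract H e) true

data HasType {n m} (S : Fin m → Bool)
     : ∀ {k} → Minor n m → DTree m k → Fin m → EType → Set where
  atLeaf  : ∀ {H e τ H' d} → Step S H e τ H' d → HasType S H (leaf e) e τ
  atNode  : ∀ {k H e τ H' d} {l r : DTree m k} →
            Step S H e τ H' d → HasType S H (node e l r) e τ
  goLeft  : ∀ {k H e τ H' f σ} {l r : DTree m k} →
            Step S H e τ H' false → HasType S H' l f σ →
            HasType S H (node e l r) f σ
  goRight : ∀ {k H e τ H' f σ} {l r : DTree m k} →
            Step S H e τ H' true → HasType S H' r f σ →
            HasType S H (node e l r) f σ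

ΔType : (G : Graph) → ∀ {k} → DTree (nE G) k → Subgraph G → Fin (nE G) → EType → Set
ΔType G Δ S f τ = HasType S (initial G) Δ f τ

module Submission where

-- Fix a spanning tree T of G.  Say that T "induces a spanning
-- forest" of a minor H when (a) no edge of T ∩ H has its ends joined by the
-- other edges of T ∩ H, and (b) the ends of every edge of H are joined in
-- T ∩ H.  For the initial minor G this is exactly acyclicity and
-- connectivity of T.  The invariant survives the two moves the Δ-process
-- makes on T: deleting an edge outside T (its ends stay joined through T),
-- and contracting an edge of T (walks are pushed down to, and lifted back
-- from, the contraction).  Under the invariant a loop cannot lie in T by (a),
-- and an isthmus must lie in T, since by (b) an edge outside T can be
-- rerouted through T.  Hence loops are only ever deleted and isthmuses only
-- contracted in agreement with T, so the invariant holds along the whole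
-- process, and the type of each edge is read off in a minor satisfying it.

open import Defs
open import Data.Nat using (ℕ; _≤_; _∸_)
open import Data.Fin using (Fin; _≟_)
open import Data.Bool using (Bool; true; false; if_then_else_)
open import Data.Product using (∃-syntax; _×_; _,_; proj₁; proj₂)
open import Data.Product using () renaming (map to ×-map)
open import Data.Sum using (_⊎_; inj₁; inj₂)
open import Data.Empty using (⊥-elim)
open import Data.List using ([]; _∷_)
open import Data.List.Membership.Propositional using (_∈_; _∉_)
open import Data.List.Relation.Unary.Any using (here; there; any?)
open import Data.List.Relation.Unary.All using (All; []; _∷_) renaming (map to mapAll)
open import Data.List.Relation.Unary.All.Properties using (¬Any⇒All¬; All¬⇒¬Any)
open import Data.List.Relation.Unary.AllPairs using ([]; _∷_)
open import Data.List.Relation.Unary.Unique.Propositional using (Unique)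
open import Relation.Nullary using (¬_; yes; no; does)
open import Relation.Binary.PropositionalEquality
open import Function using (_∘_)

module Walks {n m : ℕ} (ends : Fin m → Fin n × Fin n) where

  mapWalk : ∀ {P Q : Fin m → Set} → (∀ g → P g → Q g) →
            ∀ {u v es vs} → Walk ends P u v es vs → Walk ends Q u v es vs
  mapWalk h nil = nil
  mapWalk h (cons {f = g} p i w) = cons (h g p) i (mapWalk h w)

  mapJoined : ∀ {P Q : Fin m → Set} → (∀ g → P g → Q g) →
              ∀ {u v} → Joined ends P u v → Joined ends Q u v
  mapJoined h (_ , _ , w) = _ , _ , mapWalk h w

  walkEdges : ∀ {P u v es vs} → Walk ends P u v es vs → All P es
  walkEdges nil = []
  walkEdges (cons p _ w) = p ∷ walkEdges w

  joinedRefl : ∀ {P u v} → u ≡ v → Joined ends P u v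
  joinedRefl refl = [] , [] , nil

  joinedTrans : ∀ {P u v w} → Joined ends P u v → Joined ends P v w → Joined ends P u w
  joinedTrans (_ , _ , nil) j = j
  joinedTrans (_ , _ , cons p i w) j with joinedTrans (_ , _ , w) j
  ... | _ , _ , w' = _ , _ , cons p i w'

  incidSym : ∀ {f u w} → Incid ends f u w → Incid ends f w u
  incidSym (inj₁ eq) = inj₂ eq
  incidSym (inj₂ eq) = inj₁ eq

  edgeJoined : ∀ {P f u w} → P f → Incid ends f u w → Joined ends P u w
  edgeJoined p i = _ , _ , cons p i nil

  joinedSym : ∀ {P u v} → Joined ends P u v → Joined ends P v u
  joinedSym (_ , _ , nil) = joinedRefl refl
  joinedSym (_ , _ , cons p i w) = joinedTrans (joinedSym (_ , _ , w)) (edgeJoined p (incidSym i))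

  alongEdge : ∀ {P g x y} → Joined ends P (proj₁ (ends g)) (proj₂ (ends g)) →
              Incid ends g x y → Joined ends P x y
  alongEdge j (inj₁ eq) = subst₂ (Joined ends _) (cong proj₁ eq) (cong proj₂ eq) j
  alongEdge j (inj₂ eq) = joinedSym (subst₂ (Joined ends _) (cong proj₁ eq) (cong proj₂ eq) j)

  data SimpleWalk (P : Fin m → Set) (x y : Fin n) : Set where
    simple : ∀ {es vs} → Walk ends P x y es vs → Unique vs → y ∉ vs → SimpleWalk P x y

  startRecorded : ∀ {P w y es vs} → Walk ends P w y es vs → w ∈ vs ⊎ w ≡ y
  startRecorded nil = inj₂ refl
  startRecorded (cons _ _ _) = inj₁ (here refl)

  traversedEdge : ∀ {P w y es vs g} → Walk ends P w y es vs → g ∈ es →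
                  ∃[ p ] ∃[ q ] (Incid ends g p q × p ∈ vs × (q ∈ vs ⊎ q ≡ y))
  traversedEdge (cons {u = u} {w = w} _ i rest) (here refl) with startRecorded rest
  ... | inj₁ w∈ = u , w , i , here refl , inj₁ (there w∈)
  ... | inj₂ w≡y = u , w , i , here refl , inj₂ w≡y
  traversedEdge (cons _ _ rest) (there k) with traversedEdge rest k
  ... | p , q , i , p∈ , inj₁ q∈ = p , q , i , there p∈ , inj₁ (there q∈)
  ... | p , q , i , p∈ , inj₂ q≡y = p , q , i , there p∈ , inj₂ q≡y

  sharedEnd : ∀ {g x w p q} → Incid ends g x w → Incid ends g p q → p ≡ x ⊎ q ≡ x
  sharedEnd (inj₁ e₁) (inj₁ e₂) = inj₁ (cong proj₁ (trans (sym e₂) e₁))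
  sharedEnd (inj₁ e₁) (inj₂ e₂) = inj₂ (cong proj₁ (trans (sym e₂) e₁))
  sharedEnd (inj₂ e₁) (inj₁ e₂) = inj₂ (cong proj₂ (trans (sym e₂) e₁))
  sharedEnd (inj₂ e₁) (inj₂ e₂) = inj₁ (cong proj₂ (trans (sym e₂) e₁))

  simpleEdgesUnique : ∀ {P x y es vs} → Walk ends P x y es vs → Unique vs → y ∉ vs → Unique es
  simpleEdgesUnique nil _ _ = []
  simpleEdgesUnique {x = x} {y} (cons {f = g} {es = es} {vs = vs} _ i rest) (x∉ ∷ U) y∉ =
    ¬Any⇒All¬ es notLater ∷ simpleEdgesUnique rest U (y∉ ∘ there)
    where
    notLater : g ∉ es
    notLater k with traversedEdge rest k
    ... | p , q , i' , p∈ , q∈ with sharedEnd i i' | q∈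
    ... | inj₁ refl | _ = All¬⇒¬Any x∉ p∈
    ... | inj₂ refl | inj₁ q∈vs = All¬⇒¬Any x∉ q∈vs
    ... | inj₂ refl | inj₂ x≡y = y∉ (here (sym x≡y))

  suffixFrom : ∀ {P x₀ x y es vs} → Walk ends P x₀ y es vs → Unique vs → y ∉ vs →
               x ∈ vs → SimpleWalk P x y
  suffixFrom w@(cons _ _ _) U y∉ (here refl) = simple w U y∉
  suffixFrom (cons _ _ rest) (_ ∷ U) y∉ (there k) = suffixFrom rest U (y∉ ∘ there) k

  shorten : ∀ {P x y es vs} → Walk ends P x y es vs → SimpleWalk P x y
  shorten nil = simple nil [] (λ ())
  shorten {x = x} {y} (cons p i rest) with shorten rest
  ... | simple {vs = vs} w U y∉ with any? (x ≟_) vs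
  ...   | yes x∈ = suffixFrom w U y∉ x∈
  ...   | no x∉ with x ≟ y
  ...     | yes refl = simple nil [] (λ ())
  ...     | no x≢y = simple (cons p i w) (¬Any⇒All¬ vs x∉ ∷ U) fresh
    where
    fresh : y ∉ x ∷ vs
    fresh (here y≡x) = x≢y (sym y≡x)
    fresh (there k) = y∉ k

  closeCycle : ∀ {P f x y} → P f → Incid ends f y x →
               SimpleWalk (λ g → P g × g ≢ f) x y → HasCycle ends P
  closeCycle {f = f} {y = y} pf i (simple {es} {vs} w U y∉) =
    y , f ∷ es , y ∷ vs , cons pf i (mapWalk (λ _ → proj₁) w) , (λ ()) ,
    (mapAll (λ q f≡g → proj₂ q (sym f≡g)) (walkEdges w) ∷ simpleEdgesUnique w U y∉) ,
    (¬Any⇒All¬ vs y∉ ∷ U)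

  acyclicBridge : ∀ {P f} → ¬ HasCycle ends P → P f →
                  ¬ Joined ends (λ g → P g × g ≢ f) (proj₁ (ends f)) (proj₂ (ends f))
  acyclicBridge acyclic pf (_ , _ , w) = acyclic (closeCycle pf (inj₂ refl) (shorten w))

open Walks

presentAfterDelete : ∀ {n m} (H : Minor n m) e f → Present (delete H e) f → f ≢ e × Present H f
presentAfterDelete H e f p with f ≟ e
... | no f≢e = f≢e , p

presentInDelete : ∀ {n m} (H : Minor n m) e f → f ≢ e → Present H f → Present (delete H e) f
presentInDelete H e f f≢e p with f ≟ e
... | yes f≡e = ⊥-elim (f≢e f≡e)
... | no _ = p

module Contraction {n m : ℕ} (H : Minor n m) (e : Fin m) where

  a b : Fin n
  a = proj₁ (mends H e)
  b = proj₂ (mends H e)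

  merge : Fin n → Fin n
  merge x = if does (x ≟ b) then a else x

  mergeCases : ∀ x → (x ≡ b × merge x ≡ a) ⊎ merge x ≡ x
  mergeCases x with x ≟ b
  ... | yes x≡b = inj₁ (x≡b , refl)
  ... | no _ = inj₂ refl

  mergeA : merge a ≡ a
  mergeA with mergeCases a
  ... | inj₁ (_ , eq) = eq
  ... | inj₂ eq = eq

  mergeB : merge b ≡ a
  mergeB with b ≟ b
  ... | yes _ = refl
  ... | no b≢b = ⊥-elim (b≢b refl)

  mergeEnds : ∀ {x w} → Incid (mends H) e x w → merge x ≡ merge w
  mergeEnds {x} {w} (inj₁ eq) = begin
    merge x ≡⟨ cong (merge ∘ proj₁) (sym eq) ⟩ merge a ≡⟨ mergeA ⟩ a
            ≡⟨ sym mergeB ⟩ merge b ≡⟨ cong (merge ∘ proj₂) eq ⟩ merge w ∎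
    where open ≡-Reasoning
  mergeEnds {x} {w} (inj₂ eq) = begin
    merge x ≡⟨ cong (merge ∘ proj₂) (sym eq) ⟩ merge b ≡⟨ mergeB ⟩ a
            ≡⟨ sym mergeA ⟩ merge a ≡⟨ cong (merge ∘ proj₁) eq ⟩ merge w ∎
    where open ≡-Reasoning

  H/e : Minor n m
  H/e = contract H e

  contractWalk : ∀ {P Q : Fin m → Set} → (∀ g → g ≢ e → P g → Q g) →
                 ∀ {x y es vs} → Walk (mends H) P x y es vs →
                 Joined (mends H/e) Q (merge x) (merge y)
  contractWalk h nil = joinedRefl (mends H/e) refl
  contractWalk {Q = Q} h {y = y} (cons {f = g} p i rest) with g ≟ e
  ... | no g≢e = joinedTrans (mends H/e) (edgeJoined (mends H/e) (h g g≢e p) (mergeIncid i))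
                   (contractWalk h rest)
    where
    mergeIncid : ∀ {x w} → Incid (mends H) g x w → Incid (mends H/e) g (merge x) (merge w)
    mergeIncid (inj₁ eq) = inj₁ (cong (×-map merge merge) eq)
    mergeIncid (inj₂ eq) = inj₂ (cong (×-map merge merge) eq)
  ... | yes refl = subst (λ z → Joined (mends H/e) Q z (merge y)) (sym (mergeEnds i))
                     (contractWalk h rest)

  mergedJoined : ∀ {P} → P e → ∀ {x y} → merge x ≡ merge y → Joined (mends H) P x y
  mergedJoined pe {x} {y} eq with mergeCases x | mergeCases y
  ... | inj₁ (refl , _) | inj₁ (refl , _) = joinedRefl (mends H) refl
  ... | inj₁ (refl , mx) | inj₂ my =
    subst (Joined (mends H) _ b) (trans (sym mx) (trans eq my)) (edgeJoined (mends H) pe (inj₂ refl))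
  ... | inj₂ mx | inj₁ (refl , my) =
    subst (λ z → Joined (mends H) _ z b) (trans (sym my) (trans (sym eq) mx))
      (edgeJoined (mends H) pe (inj₁ refl))
  ... | inj₂ mx | inj₂ my = joinedRefl (mends H) (trans (sym mx) (trans eq my))

  liftIncid : ∀ {g z w} → Incid (mends H/e) g z w →
              ∃[ p ] ∃[ q ] (Incid (mends H) g p q × merge p ≡ z × merge q ≡ w)
  liftIncid (inj₁ eq) = _ , _ , inj₁ refl , cong proj₁ eq , cong proj₂ eq
  liftIncid (inj₂ eq) = _ , _ , inj₂ refl , cong proj₂ eq , cong proj₁ eq

  liftWalk : ∀ {P Q : Fin m → Set} → P e → (∀ g → Q g → P g) →
             ∀ {z z' es vs} → Walk (mends H/e) Q z z' es vs →
             ∀ {x y} → merge x ≡ z → merge y ≡ z' → Joined (mends H) P x y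
  liftWalk pe h nil mx my = mergedJoined pe (trans mx (sym my))
  liftWalk pe h (cons {f = g} qg i rest) mx my with liftIncid i
  ... | p , q , i' , mp , mq =
    joinedTrans (mends H) (mergedJoined pe (trans mx (sym mp)))
      (joinedTrans (mends H) (edgeJoined (mends H) (h g qg) i') (liftWalk pe h rest mq my))

module Forest {n m : ℕ} (T : Fin m → Bool) where

  TEdge : Minor n m → Fin m → Set
  TEdge H g = Present H g × T g ≡ true

  EndsJoinedBy : (H : Minor n m) → (Fin m → Set) → Fin m → Set
  EndsJoinedBy H P f = Joined (mends H) P (proj₁ (mends H f)) (proj₂ (mends H f))

  record SpanningForest (H : Minor n m) : Set where
    field
      bridges : ∀ f → TEdge H f → ¬ EndsJoinedBy H (λ g → TEdge H g × g ≢ f) f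
      spans   : ∀ f → Present H f → EndsJoinedBy H (TEdge H) f
  open SpanningForest

  distinctByT : ∀ {g e} → T g ≡ true → T e ≡ false → g ≢ e
  distinctByT tg te refl with trans (sym tg) te
  ... | ()

  tEdgeBefore : ∀ H e {g} → TEdge (delete H e) g → TEdge H g
  tEdgeBefore H e {g} (p , t) = proj₂ (presentAfterDelete H e g p) , t

  -- A loop is never an edge of T, since it would be joined to itself.
  loopNotInT : ∀ {H e} → SpanningForest H → IsLoop H e → T e ≡ false
  loopNotInT {H} {e} F (pe , a≡b) with T e in te
  ... | false = refl
  ... | true = ⊥-elim (bridges F e (pe , te) (joinedRefl (mends H) a≡b))

  -- Deleting an edge outside T disconnects nothing: T still joins its ends.
  deleteKeepsJoined : ∀ {H e} → SpanningForest H → T e ≡ false →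
                      ∀ {u v es vs} → Walk (mends H) (Present H) u v es vs →
                      JoinedIn (delete H e) u v
  deleteKeepsJoined {H} F te nil = joinedRefl (mends H) refl
  deleteKeepsJoined {H} {e} F te (cons {f = g} p i rest) with g ≟ e
  ... | no g≢e = joinedTrans (mends H) (edgeJoined (mends H) (presentInDelete H e g g≢e p) i)
                   (deleteKeepsJoined F te rest)
  ... | yes refl = joinedTrans (mends H) (alongEdge (mends H) (mapJoined (mends H) survives (spans F g p)) i)
                     (deleteKeepsJoined F te rest)
    where
    survives : ∀ h → TEdge H h → Present (delete H g) h
    survives h (ph , th) = presentInDelete H g h (distinctByT th te) ph

  isthmusInT : ∀ {H e} → SpanningForest H → IsIsthmus H e → T e ≡ true
  isthmusInT {e = e} F (_ , _ , _ , (_ , _ , w) , disconnected) with T e in te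
  ... | true = refl
  ... | false = ⊥-elim (disconnected (deleteKeepsJoined F te w))

  deletePreserves : ∀ {H e} → SpanningForest H → T e ≡ false → SpanningForest (delete H e)
  bridges (deletePreserves {H} {e} F te) f tf j =
    bridges F f (tEdgeBefore H e tf) (mapJoined (mends H) (λ g (tg , g≢f) → tEdgeBefore H e tg , g≢f) j)
  spans (deletePreserves {H} {e} F te) f p =
    mapJoined (mends H) (λ g (pg , tg) → presentInDelete H e g (distinctByT tg te) pg , tg)
      (spans F f (proj₂ (presentAfterDelete H e f p)))

  contractPreserves : ∀ {H e} → SpanningForest H → TEdge H e → SpanningForest (contract H e)
  bridges (contractPreserves {H} {e} F te) f tf (_ , _ , w) =
    bridges F f (tEdgeBefore H e tf)
      (liftWalk (te , e≢f) (λ g (tg , g≢f) → tEdgeBefore H e tg , g≢f) w refl refl)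
    where
    open Contraction H e
    e≢f : e ≢ f
    e≢f = proj₁ (presentAfterDelete H e f (proj₁ tf)) ∘ sym
  spans (contractPreserves {H} {e} F te) f p =
    contractWalk (λ g g≢e (pg , tg) → presentInDelete H e g g≢e pg , tg)
      (proj₂ (proj₂ (spans F f (proj₂ (presentAfterDelete H e f p)))))
    where open Contraction H e

  stepPreserves : ∀ {H e τ H' d} → SpanningForest H → Step T H e τ H' d → SpanningForest H'
  stepPreserves F (stepSe _ notInT) = deletePreserves F notInT
  stepPreserves F (stepL loop) = deletePreserves F (loopNotInT F loop)
  stepPreserves F (stepSi (pe , _) inT) = contractPreserves F (pe , inT)
  stepPreserves F (stepI isthmus) = contractPreserves F (proj₁ isthmus , isthmusInT F isthmus)

  typedInForest : ∀ {k H} {t : DTree m k} {f τ} → SpanningForest H → HasType T H t f τ →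
                  ∃[ H₀ ] (SpanningForest H₀ × ∃[ H₁ ] ∃[ d ] Step T H₀ f τ H₁ d)
  typedInForest F (atLeaf s) = _ , F , _ , _ , s
  typedInForest F (atNode s) = _ , F , _ , _ , s
  typedInForest F (goLeft s h) = typedInForest (stepPreserves F s) h
  typedInForest F (goRight s h) = typedInForest (stepPreserves F s) h

spanningTreeForest : (G : Graph) (T : Subgraph G) → IsSpanningTree G T →
                     Forest.SpanningForest {nV G} T (initial G)
spanningTreeForest G T (connected , acyclic) = record
  { bridges = λ f (_ , tf) j →
      acyclicBridge (ends G) acyclic tf (mapJoined (ends G) (λ g ((_ , tg) , g≢f) → tg , g≢f) j)
  ; spans = λ f _ → mapJoined (ends G) (λ g tg → refl , tg) (connected _ _)
  }

proposition4p2 : (G : Graph) → GraphConnected G → 1 ≤ nE G →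
    (Δ : DTree (nE G) (nE G ∸ 1)) → IsDecisionTree Δ →
    (T : Subgraph G) → IsSpanningTree G T →
    (e : Fin (nE G)) →
      (ΔType G Δ T e I → T e ≡ true) × (ΔType G Δ T e L → T e ≡ false)
proposition4p2 G _ _ Δ _ T tree e = isthmusType , loopType
  where
  open Forest {nV G} T
  start : SpanningForest (initial G)
  start = spanningTreeForest G T tree

  isthmusType : ΔType G Δ T e I → T e ≡ true
  isthmusType h with typedInForest start h
  ... | _ , F , _ , _ , stepI isthmus = isthmusInT F isthmus

  loopType : ΔType G Δ T e L → T e ≡ false
  loopType h with typedInForest start h
  ... | _ , F , _ , _ , stepL loop = loopNotInT F loop
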